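{- Let $N$ be a positive integer and let $A$ be a subset of $\{0,1,\ldots,N-1\}$ with $|A| \geq 2N/3+1$. Then for every positive integer $d < |A|$ there are elements $g_1,g_2 \in A$ such that $d=g_1-g_2$. -}

module Defs where

-- Suppose no two elements of A differ by d. In a window [a, a + 2d) the map
-- x ↦ x + d pairs the first half with the second, and at most one element of
-- each pair lies in A, so the window holds at most d elements of A. Cutting
-- [0, N) into q such windows and a rest of length r < 2d gives
-- |A| ≤ q d + min(r, d). For q = 0 this contradicts d < |A|; for q ≥ 1 it
-- gives 3|A| ≤ 2N, contradicting 3|A| ≥ 2N + 3.
module Submission where

open import Defs
open import Data.Bool using (Bool; true; false)
open import Data.Empty using (⊥; ⊥-elim)
open import Data.Fin using (Fin; toℕ)
open import Data.Fin.Subset using (Subset; _∈_; ∣_∣)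
open import Data.Nat using (ℕ; zero; suc; _+_; _*_; _≤_; _<_; _⊓_; _∸_; _/_; _%_; NonZero; >-nonZero; z≤n; s≤s)
open import Data.Nat.DivMod using (m≡m%n+[m/n]*n; m%n<n)
open import Data.Nat.Properties
open import Data.Nat.Tactic.RingSolver using (solve-∀)
open import Data.Product using (∃-syntax; _×_; _,_)
open import Data.Sum using (_⊎_; inj₁; inj₂; [_,_]′)
open import Data.Vec using (_∷_; []; here; there)
open import Function using (_∘_)
open import Relation.Binary.PropositionalEquality using (_≡_; refl; sym; trans; cong; subst)

indicator : Bool → ℕ
indicator true  = 1
indicator false = 0

indicator≤1 : ∀ b → indicator b ≤ 1
indicator≤1 true  = s≤s z≤n
indicator≤1 false = z≤n

count : (ℕ → Bool) → ℕ → ℕ → ℕ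
count f a zero    = 0
count f a (suc m) = indicator (f a) + count f (suc a) m

HasDifference : (ℕ → Bool) → ℕ → Set
HasDifference f d = ∃[ x ] (f x ≡ true × f (d + x) ≡ true)

count-suc : ∀ f a m → count f (suc a) m ≡ count (f ∘ suc) a m
count-suc f a zero    = refl
count-suc f a (suc m) = cong (indicator (f (suc a)) +_) (count-suc f (suc a) m)

module _ (f : ℕ → Bool) where

  count-+ : ∀ a m n → count f a (m + n) ≡ count f a m + count f (a + m) n
  count-+ a zero    n = cong (λ b → count f b n) (sym (+-identityʳ a))
  count-+ a (suc m) n rewrite count-+ (suc a) m n | +-suc a m =
    sym (+-assoc (indicator (f a)) (count f (suc a) m) _)

  count≤length : ∀ a m → count f a m ≤ m
  count≤length a zero    = z≤n
  count≤length a (suc m) = +-mono-≤ (indicator≤1 (f a)) (count≤length (suc a) m)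

  count-monoʳ-≤ : ∀ a {m n} → m ≤ n → count f a m ≤ count f a n
  count-monoʳ-≤ a {m} {n} m≤n = begin
    count f a m                             ≤⟨ m≤m+n _ _ ⟩
    count f a m + count f (a + m) (n ∸ m)   ≡⟨ count-+ a m (n ∸ m) ⟨
    count f a (m + (n ∸ m))                 ≡⟨ cong (count f a) (m+[n∸m]≡n m≤n) ⟩
    count f a n                             ∎
    where open ≤-Reasoning

  module _ (d : ℕ) where

    count-+-translate : ∀ a m → HasDifference f d ⊎ count f a m + count f (d + a) m ≤ m
    count-+-translate a zero = inj₂ z≤n
    count-+-translate a (suc m) with count-+-translate (suc a) m | f a in fa | f (d + a) in fda
    ... | inj₁ diff | _     | _     = inj₁ diff
    ... | inj₂ _    | true  | true  = inj₁ (a , fa , fda)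
    ... | inj₂ h    | true  | false rewrite +-suc d a = inj₂ (s≤s h)
    ... | inj₂ h    | false | true  rewrite +-suc d a = inj₂ (≤-trans (≤-reflexive (+-suc _ _)) (s≤s h))
    ... | inj₂ h    | false | false rewrite +-suc d a = inj₂ (m≤n⇒m≤1+n h)

    count-window : ∀ a → HasDifference f d ⊎ count f a (d + d) ≤ d
    count-window a with count-+-translate a d
    ... | inj₁ diff = inj₁ diff
    ... | inj₂ h rewrite count-+ a d d | +-comm a d = inj₂ h

    count-windows : ∀ j a → HasDifference f d ⊎ count f a (j * (d + d)) ≤ j * d
    count-windows zero    a = inj₂ z≤n
    count-windows (suc j) a with count-window a | count-windows j (a + (d + d))
    ... | inj₁ diff | _         = inj₁ diff
    ... | inj₂ _    | inj₁ diff = inj₁ diff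
    ... | inj₂ h    | inj₂ h′ rewrite count-+ a (d + d) (j * (d + d)) = inj₂ (+-mono-≤ h h′)

    count-short : ∀ a r → r ≤ d + d → HasDifference f d ⊎ count f a r ≤ r ⊓ d
    count-short a r r≤2d with count-window a
    ... | inj₁ diff = inj₁ diff
    ... | inj₂ h    = inj₂ (⊓-glb (count≤length a r) (≤-trans (count-monoʳ-≤ a r≤2d) h))

    count-bound : ∀ a q r → r ≤ d + d →
                  HasDifference f d ⊎ count f a (q * (d + d) + r) ≤ q * d + r ⊓ d
    count-bound a q r r≤2d with count-windows q a | count-short (a + q * (d + d)) r r≤2d
    ... | inj₁ diff | _         = inj₁ diff
    ... | inj₂ _    | inj₁ diff = inj₁ diff
    ... | inj₂ h    | inj₂ h′ rewrite count-+ a (q * (d + d)) r = inj₂ (+-mono-≤ h h′)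

small-or-sparse : ∀ q d r k → k ≤ q * d + r ⊓ d → k ≤ d ⊎ 3 * k ≤ 2 * (q * (d + d) + r)
small-or-sparse zero    d r k k≤ = inj₁ (≤-trans k≤ (m⊓n≤n r d))
small-or-sparse (suc p) d r k k≤ = inj₂ (begin
    3 * k                            ≤⟨ *-monoʳ-≤ 3 k≤ ⟩
    3 * (q * d + c)                  ≡⟨ expand-left q d c ⟩
    3 * (q * d) + c + 2 * c          ≤⟨ +-mono-≤ (+-monoʳ-≤ (3 * (q * d)) c≤qd) (*-monoʳ-≤ 2 (m⊓n≤m r d)) ⟩
    3 * (q * d) + q * d + 2 * r      ≡⟨ expand-right q d r ⟨
    2 * (q * (d + d) + r)            ∎)
  where
  open ≤-Reasoning
  q = suc p
  c = r ⊓ d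
  c≤qd : c ≤ q * d
  c≤qd = ≤-trans (m⊓n≤n r d) (m≤m+n d (p * d))
  expand-left : ∀ q d c → 3 * (q * d + c) ≡ 3 * (q * d) + c + 2 * c
  expand-left = solve-∀
  expand-right : ∀ q d r → 2 * (q * (d + d) + r) ≡ 3 * (q * d) + q * d + 2 * r
  expand-right = solve-∀

member : ∀ {n} → Subset n → ℕ → Bool
member []      x       = false
member (b ∷ A) zero    = b
member (b ∷ A) (suc x) = member A x

∣∣≡count-member : ∀ {n} (A : Subset n) → ∣ A ∣ ≡ count (member A) 0 n
∣∣≡count-member []                = refl
∣∣≡count-member {suc n} (true ∷ A)  = cong suc (trans (∣∣≡count-member A) (sym (count-suc (member (true ∷ A)) 0 n)))
∣∣≡count-member {suc n} (false ∷ A) = trans (∣∣≡count-member A) (sym (count-suc (member (false ∷ A)) 0 n))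

member⇒∈ : ∀ {n} (A : Subset n) x → member A x ≡ true → ∃[ i ] (toℕ i ≡ x × i ∈ A)
member⇒∈ (true ∷ A) zero    refl = Fin.zero , refl , here
member⇒∈ (b ∷ A)    (suc x) e with member⇒∈ A x e
... | i , refl , i∈A = Fin.suc i , refl , there i∈A

difference⇒pair : ∀ {n} (A : Subset n) d → HasDifference (member A) d →
                  ∃[ g₁ ] ∃[ g₂ ] (g₁ ∈ A × g₂ ∈ A × toℕ g₁ ≡ d + toℕ g₂)
difference⇒pair A d (x , x∈A , d+x∈A) with member⇒∈ A x x∈A | member⇒∈ A (d + x) d+x∈A
... | g₂ , refl , g₂∈A | g₁ , g₁≡d+x , g₁∈A = g₁ , g₂ , g₁∈A , g₂∈A , g₁≡d+x

lemma1 : (N : ℕ) → .{{_ : NonZero N}} → (A : Subset N) →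
         2 * N + 3 ≤ 3 * ∣ A ∣ →
         (d : ℕ) → 1 ≤ d → d < ∣ A ∣ →
         ∃[ g₁ ] ∃[ g₂ ] (g₁ ∈ A × g₂ ∈ A × toℕ g₁ ≡ d + toℕ g₂)
lemma1 N A dense d 1≤d d<∣A∣ =
  [ difference⇒pair A d , ⊥-elim ∘ impossible ]′
    (count-bound (member A) d 0 q r (<⇒≤ (m%n<n N (d + d))))
  where
  instance
    2d≢0 : NonZero (d + d)
    2d≢0 = >-nonZero (≤-trans 1≤d (m≤m+n d d))
  q = N / (d + d)
  r = N % (d + d)
  N≡q*2d+r : N ≡ q * (d + d) + r
  N≡q*2d+r = trans (m≡m%n+[m/n]*n N (d + d)) (+-comm r (q * (d + d)))
  count≡∣A∣ : count (member A) 0 (q * (d + d) + r) ≡ ∣ A ∣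
  count≡∣A∣ = trans (cong (count (member A) 0) (sym N≡q*2d+r)) (sym (∣∣≡count-member A))
  impossible : count (member A) 0 (q * (d + d) + r) ≤ q * d + r ⊓ d → ⊥
  impossible bound with small-or-sparse q d r ∣ A ∣ (subst (_≤ q * d + r ⊓ d) count≡∣A∣ bound)
  ... | inj₁ ∣A∣≤d = <⇒≱ d<∣A∣ ∣A∣≤d
  ... | inj₂ sparse =
    m+1+n≰m (2 * N) (≤-trans dense (subst (λ n → 3 * ∣ A ∣ ≤ 2 * n) (sym N≡q*2d+r) sparse))
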